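{- Let $x$ and $z$ be finite words such that $x$ is a power of $z$ and $|z|\leq |x|$. If $\Gamma$ is a string attractor of $z$, then $\Gamma\cup\{|z|-1\}$ is a string attractor of $x$.
   Context: For a finite word $w=w_0w_1\cdots w_{n-1}$ (letters $w_i$), a (string) attractor of $w$ is a set $\Gamma\subseteq\{0,1,\dots,n-1\}$ such that every non-empty factor $f$ of $w$ has an occurrence $w_iw_{i+1}\cdots w_{j-1}=f$ with $\{i,i+1,\dots,j-1\}\cap\Gamma\neq\emptyset$. A word $u$ is a power of a word $v$ if $u=v^kv'$ for some $k\in\mathbb N$ and some prefix $v'$ of $v$. -}

module Defs where

open import Data.Nat using (ℕ; _≤_; _<_; _∸_)
open import Data.List using (List; length; take; drop; _++_; concat; replicate)
open import Relation.Binary.PropositionalEquality using (_≡_)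
open import Data.Product using (Σ; _×_; ∃-syntax)
open import Level using (_⊔_)

-- Words over an alphabet A are lists; positions are 0-based naturals.

-- The factor w_i w_{i+1} ... w_{j-1} (meaningful when i ≤ j ≤ |w|).
factor : ∀ {a} {A : Set a} → List A → ℕ → ℕ → List A
factor w i j = take (j ∸ i) (drop i w)

IsPrefix : ∀ {a} {A : Set a} → List A → List A → Set a
IsPrefix v' v = ∃[ u ] (v' ++ u ≡ v)

IsPowerOf : ∀ {a} {A : Set a} → List A → List A → Set a
IsPowerOf u v = ∃[ k ] ∃[ v' ] (IsPrefix v' v × (u ≡ concat (replicate k v) ++ v'))

-- String attractor: Γ ⊆ {0,…,n-1} and every non-empty factor, i.e. every
-- occurrence (i , j) with i < j ≤ n, has an occurrence (i' , j') with the
-- same content crossing a position of Γ.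
IsAttractor : ∀ {a ℓ} {A : Set a} → List A → (ℕ → Set ℓ) → Set (a ⊔ ℓ)
IsAttractor w Γ =
  (∀ k → Γ k → k < length w) ×
  (∀ i j → i < j → j ≤ length w →
    ∃[ i' ] ∃[ j' ] (i' < j' × j' ≤ length w ×
      factor w i' j' ≡ factor w i j ×
      ∃[ k ] (Γ k × i' ≤ k × k < j')))

-- A word x is a power of z exactly when x is a prefix of z x; then x has period p = |z|, so
-- shifting an occurrence left by a multiple of p gives an occurrence of the same factor
-- starting before p. If that occurrence ends by p it lies inside the prefix z and the
-- attractor of z supplies an occurrence crossing Γ; otherwise it already contains p − 1.
module Submission where

open import Defs
open import Level using (_⊔_)
open import Data.Nat using (ℕ; zero; suc; _+_; _*_; _∸_; _≤_; _<_; _≤?_; s≤s; z<s; NonZero; >-nonZero)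
open import Data.Nat.Properties
open import Data.Nat.DivMod using (_%_; _/_; m≡m%n+[m/n]*n; m%n<n; m/n*n≤m)
open import Data.List using (List; []; _∷_; _++_; length; concat; replicate)
open import Data.List.Properties using (++-assoc; ∷-injective; length-++-≤ˡ)
open import Data.Product using (_×_; _,_; ∃-syntax)
open import Data.Sum using (_⊎_; inj₁; inj₂)
open import Relation.Nullary using (yes; no)
open import Relation.Binary.PropositionalEquality using (_≡_; refl; sym; trans; cong; cong₂; subst; subst₂; module ≡-Reasoning)

module _ {a} {A : Set a} where

  isPrefix-length : {u w : List A} → IsPrefix u w → length u ≤ length w
  isPrefix-length {u} (_ , refl) = length-++-≤ˡ u

  isPrefix-++ˡ : ∀ (v : List A) {u w} → IsPrefix u w → IsPrefix (v ++ u) (v ++ w)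
  isPrefix-++ˡ v {u} (s , refl) = s , ++-assoc v u s

  isPrefix-byLength : {u v w : List A} → IsPrefix u w → IsPrefix v w → length u ≤ length v → IsPrefix u v
  isPrefix-byLength {[]}    {v}     _          _       _         = v , refl
  isPrefix-byLength {a ∷ u} {b ∷ v} (s , refl) (t , e) (s≤s u≤v) with ∷-injective e
  ... | refl , e′ with isPrefix-byLength (s , refl) (t , e′) u≤v
  ...   | r , refl = r , refl

  power⇒isPrefix-++ : {x z : List A} → IsPowerOf x z → IsPrefix x (z ++ x)
  power⇒isPrefix-++ {z = z} (k , v′ , (u , v′u≡z) , refl) = prefix-of-next-power k
    where
    prefix-of-next-power : ∀ k → IsPrefix (concat (replicate k z) ++ v′) (z ++ concat (replicate k z) ++ v′)
    prefix-of-next-power zero    = u ++ v′ , trans (sym (++-assoc v′ u v′)) (cong (_++ v′) v′u≡z)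
    prefix-of-next-power (suc k) rewrite ++-assoc z (concat (replicate k z)) v′ =
      isPrefix-++ˡ z (prefix-of-next-power k)

  factor-++ˡ : ∀ (u t : List A) i j → j ≤ length u → factor (u ++ t) i j ≡ factor u i j
  factor-++ˡ u       t zero    zero    _         = refl
  factor-++ˡ u       t (suc i) zero    _         = refl
  factor-++ˡ (x ∷ u) t zero    (suc j) (s≤s j≤u) = cong (x ∷_) (factor-++ˡ u t zero j j≤u)
  factor-++ˡ (x ∷ u) t (suc i) (suc j) (s≤s j≤u) = factor-++ˡ u t i j j≤u

  factor-++ʳ : ∀ (u w : List A) i j → factor (u ++ w) (length u + i) (length u + j) ≡ factor w i j
  factor-++ʳ []      w i j = refl
  factor-++ʳ (x ∷ u) w i j = factor-++ʳ u w i j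

  factor-isPrefix : {u w : List A} → IsPrefix u w → ∀ i j → j ≤ length u → factor w i j ≡ factor u i j
  factor-isPrefix {u} (t , refl) = factor-++ˡ u t

  -- IsAttractor w Γ is, definitionally, a bound on Γ together with
  -- ∀ i j → i < j → j ≤ length w → OccursAcross w Γ i j.
  OccursAcross : ∀ {ℓ} → List A → (ℕ → Set ℓ) → ℕ → ℕ → Set (a ⊔ ℓ)
  OccursAcross w Γ i j = ∃[ i′ ] ∃[ j′ ] (i′ < j′ × j′ ≤ length w ×
    factor w i′ j′ ≡ factor w i j × ∃[ k ] (Γ k × i′ ≤ k × k < j′))

  occursAcross-here : ∀ {ℓ} {w : List A} {Γ : ℕ → Set ℓ} {i j k} →
    Γ k → i ≤ k → k < j → j ≤ length w → OccursAcross w Γ i j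
  occursAcross-here {k = k} k∈Γ i≤k k<j j≤n =
    _ , _ , ≤-<-trans i≤k k<j , j≤n , refl , k , k∈Γ , i≤k , k<j

  occursAcross-resp : ∀ {ℓ} {w : List A} {Γ : ℕ → Set ℓ} i j i₁ j₁ →
    factor w i j ≡ factor w i₁ j₁ → OccursAcross w Γ i j → OccursAcross w Γ i₁ j₁
  occursAcross-resp _ _ _ _ e (i′ , j′ , i′<j′ , j′≤n , e′ , hit) =
    i′ , j′ , i′<j′ , j′≤n , trans e′ e , hit

  occursAcross-mono : ∀ {ℓ ℓ′} {w : List A} {Γ : ℕ → Set ℓ} {Δ : ℕ → Set ℓ′} i j →
    (∀ {k} → Γ k → Δ k) → OccursAcross w Γ i j → OccursAcross w Δ i j
  occursAcross-mono _ _ Γ⊆Δ (i′ , j′ , i′<j′ , j′≤n , e , k , k∈Γ , hit) =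
    i′ , j′ , i′<j′ , j′≤n , e , k , Γ⊆Δ k∈Γ , hit

  occursAcross-isPrefix : ∀ {ℓ} {u w : List A} {Γ : ℕ → Set ℓ} i j →
    IsPrefix u w → j ≤ length u → OccursAcross u Γ i j → OccursAcross w Γ i j
  occursAcross-isPrefix i j u⊑w j≤u (i′ , j′ , i′<j′ , j′≤u , e , hit) =
    i′ , j′ , i′<j′ , ≤-trans j′≤u (isPrefix-length u⊑w) ,
    trans (factor-isPrefix u⊑w i′ j′ j′≤u) (trans e (sym (factor-isPrefix u⊑w i j j≤u))) , hit

  module Periodic {v w : List A} (w⊑vw : IsPrefix w (v ++ w)) where

    p : ℕ
    p = length v

    factor-shift : ∀ i j → p + j ≤ length w → factor w (p + i) (p + j) ≡ factor w i j
    factor-shift i j p+j≤n =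
      trans (sym (factor-isPrefix w⊑vw (p + i) (p + j) p+j≤n)) (factor-++ʳ v w i j)

    factor-shift-* : ∀ q i j → q * p + j ≤ length w → factor w (q * p + i) (q * p + j) ≡ factor w i j
    factor-shift-* zero    i j _ = refl
    factor-shift-* (suc q) i j h = begin
      factor w ((p + q * p) + i) ((p + q * p) + j) ≡⟨ cong₂ (factor w) (+-assoc p _ i) (+-assoc p _ j) ⟩
      factor w (p + (q * p + i)) (p + (q * p + j)) ≡⟨ factor-shift _ _ h′ ⟩
      factor w (q * p + i) (q * p + j)             ≡⟨ factor-shift-* q i j (≤-trans (m≤n+m _ p) h′) ⟩
      factor w i j                                 ∎
      where
      open ≡-Reasoning
      h′ : p + (q * p + j) ≤ length w
      h′ = subst (_≤ length w) (+-assoc p _ j) h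

    occurrence-before-period : .{{NonZero p}} → ∀ {i j} → i < j → j ≤ length w →
      ∃[ i₀ ] ∃[ j₀ ] (i₀ < p × i₀ < j₀ × j₀ ≤ length w × factor w i₀ j₀ ≡ factor w i j)
    occurrence-before-period {i} {j} i<j j≤n =
      i % p , j ∸ q * p , m%n<n i p ,
      +-cancelˡ-< (q * p) (i % p) (j ∸ q * p) (subst₂ _<_ (sym i≡) (sym j≡) i<j) ,
      ≤-trans (m∸n≤m j (q * p)) j≤n ,
      trans (sym (factor-shift-* q (i % p) (j ∸ q * p) (subst (_≤ length w) (sym j≡) j≤n)))
            (cong₂ (factor w) i≡ j≡)
      where
      q = i / p
      i≡ : q * p + i % p ≡ i
      i≡ = trans (+-comm (q * p) (i % p)) (sym (m≡m%n+[m/n]*n i p))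
      j≡ : q * p + (j ∸ q * p) ≡ j
      j≡ = m+[n∸m]≡n (≤-trans (m/n*n≤m i p) (<⇒≤ i<j))

    occursAcross-fromFirstPeriod : ∀ {ℓ} {Γ : ℕ → Set ℓ} .{{_ : NonZero p}} →
      (∀ i₀ j₀ → i₀ < p → i₀ < j₀ → j₀ ≤ length w → OccursAcross w Γ i₀ j₀) →
      ∀ i j → i < j → j ≤ length w → OccursAcross w Γ i j
    occursAcross-fromFirstPeriod covered₀ i j i<j j≤n with occurrence-before-period i<j j≤n
    ... | i₀ , j₀ , i₀<p , i₀<j₀ , j₀≤n , same =
      occursAcross-resp i₀ j₀ i j same (covered₀ i₀ j₀ i₀<p i₀<j₀ j₀≤n)

corollary2p4 : ∀ {a ℓ} {A : Set a} (x z : List A) (Γ : ℕ → Set ℓ) →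
    0 < length z → IsPowerOf x z → length z ≤ length x →
    IsAttractor z Γ →
    IsAttractor x (λ k → Γ k ⊎ k ≡ length z ∸ 1)
corollary2p4 x z Γ 0<p x^z p≤n (Γ<p , attracts) = bound , occursAcross-fromFirstPeriod cover
  where
  p = length z
  instance _ = >-nonZero 0<p
  x⊑zx = power⇒isPrefix-++ x^z
  z⊑x = isPrefix-byLength (x , refl) x⊑zx p≤n
  open Periodic x⊑zx using (occursAcross-fromFirstPeriod)

  Γ′ : ℕ → Set _
  Γ′ k = Γ k ⊎ k ≡ p ∸ 1

  bound : ∀ k → Γ′ k → k < length x
  bound k (inj₁ k∈Γ) = <-≤-trans (Γ<p k k∈Γ) p≤n
  bound _ (inj₂ refl) = <-≤-trans (∸-monoʳ-< z<s 0<p) p≤n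

  cover : ∀ i₀ j₀ → i₀ < p → i₀ < j₀ → j₀ ≤ length x → OccursAcross x Γ′ i₀ j₀
  cover i₀ j₀ i₀<p i₀<j₀ j₀≤n with j₀ ≤? p
  ... | yes j₀≤p =
    occursAcross-isPrefix i₀ j₀ z⊑x j₀≤p (occursAcross-mono i₀ j₀ inj₁ (attracts i₀ j₀ i₀<j₀ j₀≤p))
  ... | no  j₀≰p =
    occursAcross-here (inj₂ refl) (<⇒≤pred i₀<p) (≤-<-trans pred[n]≤n (≰⇒> j₀≰p)) j₀≤n
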